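{- Let $n\ge4$ and let $G\sim G(n,1/2)$. Then $G\in\Pi$ with probability at least $\frac{1}{2n^4}$, where $\Pi$ is the class of graphs $G$ with $\sum_{H:\,|V(H)|=4} w_H\,p(H,G)\le\frac5{16}$ and weights $w_{K_4}=1$, $w_{\overline{K_4}}=\frac12$, $w_{D_4}=\frac5{12}$, $w_{\overline{D_4}}=\frac5{12}$, $w_{P_3}=\frac13$, $w_{\overline{P_3}}=\frac16$, $w_{C_4}=\frac12$, $w_{\overline{C_4}}=\frac13$, $w_{K_{1,3}}=\frac14$, $w_{\overline{K_{1,3}}}=\frac14$, $w_{P_4}=\frac14$.
   Context: $G(n,1/2)$ is the uniformly random graph on $n$ labeled vertices (each pair is an edge independently with probability $1/2$). $p(H,G)$ is the fraction of $|V(H)|$-vertex subsets of $V(G)$ inducing in $G$ a graph isomorphic to $H$; the sum is over the 11 isomorphism classes of 4-vertex graphs. $\overline{H}$ is the complement; $K_4$ complete graph on 4 vertices; $D_4$ is $K_4$ minus an edge; $P_3$ a path on 3 vertices plus an isolated vertex; $C_4$ the 4-cycle; $P_4$ the path on 4 vertices; $K_{1,3}$ the star with 3 leaves. -}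

module Defs where

open import Data.Bool using (Bool; true; false; _∧_; _∨_; not; if_then_else_)
open import Data.Unit using (⊤; tt)
open import Data.Product using (_×_; _,_)
open import Data.Nat using (ℕ; zero; suc; _<ᵇ_; _^_)
open import Data.Nat.Combinatorics using (_C_)
open import Data.Fin using (Fin; zero; suc; toℕ)
open import Data.Fin.Properties using () renaming (_≟_ to _≟F_)
open import Data.Integer using (+_)
open import Data.List using (List; []; _∷_; [_]; map; concatMap; allFin; filterᵇ; length; foldr)
open import Data.Bool.ListAction using (all; any)
open import Data.Rational using (ℚ; _/_; _+_; _*_; _≤?_; 0ℚ)
open import Relation.Nullary.Decidable using (⌊_⌋)

-- A graph on suc n vertices = a graph on the vertices 1..n (the 'suc i')
-- together with the adjacency of the new vertex 0 to each of them.
-- This is in bijection with the 2^(n C 2) labeled simple graphs on Fin n.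

Graph : ℕ → Set
Graph zero    = ⊤
Graph (suc n) = Graph n × (Fin n → Bool)

adj : ∀ {n} → Graph n → Fin n → Fin n → Bool
adj {suc n} (g , f) zero    zero    = false
adj {suc n} (g , f) zero    (suc j) = f j
adj {suc n} (g , f) (suc i) zero    = f i
adj {suc n} (g , f) (suc i) (suc j) = adj g i j

allBoolFns : ∀ n → List (Fin n → Bool)
allBoolFns zero    = [ (λ ()) ]
allBoolFns (suc n) =
  concatMap (λ b → map (λ f → λ { zero → b ; (suc i) → f i }) (allBoolFns n))
            (true ∷ false ∷ [])

allGraphs : ∀ n → List (Graph n)
allGraphs zero    = [ tt ]
allGraphs (suc n) = concatMap (λ g → map (λ f → (g , f)) (allBoolFns n)) (allGraphs n)

Adj4 : Set
Adj4 = Fin 4 → Fin 4 → Bool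

_==_ : ∀ {n} → Fin n → Fin n → Bool
i == j = ⌊ i ≟F j ⌋

mkG : List (Fin 4 × Fin 4) → Adj4
mkG es i j = any (λ { (a , b) → ((a == i) ∧ (b == j)) ∨ ((a == j) ∧ (b == i)) }) es

compl : Adj4 → Adj4
compl A i j = not (i == j) ∧ not (A i j)

v0 v1 v2 v3 : Fin 4
v0 = zero
v1 = suc zero
v2 = suc (suc zero)
v3 = suc (suc (suc zero))

K4 D4 P3 C4 P4 K13 : Adj4
K4  = mkG ((v0 , v1) ∷ (v0 , v2) ∷ (v0 , v3) ∷ (v1 , v2) ∷ (v1 , v3) ∷ (v2 , v3) ∷ [])
D4  = mkG ((v0 , v2) ∷ (v0 , v3) ∷ (v1 , v2) ∷ (v1 , v3) ∷ (v2 , v3) ∷ [])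
P3  = mkG ((v0 , v1) ∷ (v1 , v2) ∷ [])
C4  = mkG ((v0 , v1) ∷ (v1 , v2) ∷ (v2 , v3) ∷ (v3 , v0) ∷ [])
P4  = mkG ((v0 , v1) ∷ (v1 , v2) ∷ (v2 , v3) ∷ [])
K13 = mkG ((v0 , v1) ∷ (v0 , v2) ∷ (v0 , v3) ∷ [])

allMaps4 : List (Fin 4 → Fin 4)
allMaps4 =
  concatMap (λ a → concatMap (λ b → concatMap (λ c → map (λ d →
    λ { zero → a ; (suc zero) → b ; (suc (suc zero)) → c ; (suc (suc (suc zero))) → d })
    (allFin 4)) (allFin 4)) (allFin 4)) (allFin 4)

injectiveᵇ : (Fin 4 → Fin 4) → Bool
injectiveᵇ σ = all (λ i → all (λ j → (i == j) ∨ not (σ i == σ j)) (allFin 4)) (allFin 4)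

perms4 : List (Fin 4 → Fin 4)
perms4 = filterᵇ injectiveᵇ allMaps4

isoᵇ : Adj4 → Adj4 → Bool
isoᵇ A B = any (λ σ → all (λ i → all (λ j → not (A i j) ∨ B (σ i) (σ j)) (allFin 4)
                              ∧ all (λ j → not (B (σ i) (σ j)) ∨ A i j) (allFin 4)) (allFin 4)) perms4

-- 4-vertex subsets of Fin n, as strictly increasing 4-tuples

subsets4 : ∀ n → List (Fin 4 → Fin n)
subsets4 n = filterᵇ incr
  (concatMap (λ a → concatMap (λ b → concatMap (λ c → map (λ d →
    λ { zero → a ; (suc zero) → b ; (suc (suc zero)) → c ; (suc (suc (suc zero))) → d })
    (allFin n)) (allFin n)) (allFin n)) (allFin n))
  where
  incr : (Fin 4 → Fin n) → Bool
  incr s = (toℕ (s v0) <ᵇ toℕ (s v1)) ∧ (toℕ (s v1) <ᵇ toℕ (s v2)) ∧ (toℕ (s v2) <ᵇ toℕ (s v3))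

induced : ∀ {n} → Graph n → (Fin 4 → Fin n) → Adj4
induced G s i j = adj G (s i) (s j)

-- a / b as a rational; b = 0 gives 0 (never used: b > 0 in all uses below)
frac : ℕ → ℕ → ℚ
frac a zero    = 0ℚ
frac a (suc b) = (+ a) / suc b

p : ∀ {n} → Adj4 → Graph n → ℚ
p {n} H G = frac (length (filterᵇ (λ s → isoᵇ (induced G s) H) (subsets4 n))) (n C 4)

weightedClasses : List (Adj4 × ℚ)
weightedClasses =
    (K4 , (+ 1) / 1)
  ∷ (compl K4 , (+ 1) / 2)
  ∷ (D4 , (+ 5) / 12)
  ∷ (compl D4 , (+ 5) / 12)
  ∷ (P3 , (+ 1) / 3)
  ∷ (compl P3 , (+ 1) / 6)
  ∷ (C4 , (+ 1) / 2)
  ∷ (compl C4 , (+ 1) / 3)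
  ∷ (K13 , (+ 1) / 4)
  ∷ (compl K13 , (+ 1) / 4)
  ∷ (P4 , (+ 1) / 4)
  ∷ []

weightedSum : ∀ {n} → Graph n → ℚ
weightedSum G = foldr (λ { (H , w) acc → w * p H G + acc }) 0ℚ weightedClasses

inΠᵇ : ∀ {n} → Graph n → Bool
inΠᵇ G = ⌊ weightedSum G ≤? (+ 5) / 16 ⌋

-- Pr[G(n,1/2) ∈ Π] = #{labeled graphs on Fin n in Π} / 2^(n C 2)
probΠ : ℕ → ℚ
probΠ n = frac (length (filterᵇ inΠᵇ (allGraphs n))) (2 ^ (n C 2))

-- Scale the weights by 12: then G ∈ Π iff 4·N(G) ≤ K := 15·C(n,4), where N(G) = Σ_S score(G[S]) over the
-- 4-sets S and score(A) = Σ_H 12·w_H·[A ≅ H]. For a fixed 4-set S, the symmetric differences G ↦ G ⊕ E′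
-- with graphs E′ supported on S permute the graphs on n vertices, so G[S] is uniform on the 64 labelled
-- graphs on four vertices; their total score is 240, hence E[4·N(G)] = 15·C(n,4) = K. Since 4·N(G) is an
-- integer, Markov's inequality gives Pr[4·N(G) ≥ K + 1] ≤ K/(K + 1), so Pr[G ∈ Π] ≥ 1/(K + 1), and
-- K + 1 ≤ 2n⁴ because 4!·C(n,4) ≤ n⁴.

module Submission where

open import Defs
open import Data.Bool using (Bool; true; false; not; _∧_; _∨_; _xor_; T)
open import Data.Bool.Properties using (∨-comm; ∨-idem; ∨-identityʳ; xor-comm; T-∧; T-≡)
open import Data.Fin using (Fin; zero; suc; toℕ) renaming (_≟_ to _≟ᶠ_)
open import Data.Fin.Properties using (suc-injective)
open import Data.Bool.ListAction using (and; or)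
open import Data.List using (List; []; _∷_; _++_; map; concat; concatMap; allFin; filterᵇ; length; zip)
open import Data.List.Properties using (map-cong; map-tabulate)
open import Data.List.Relation.Binary.Pointwise using (Pointwise; []; _∷_)
open import Data.Nat using (ℕ; zero; suc; pred; _+_; _*_; _∸_; _^_; _!; _≤_; _<_; _<ᵇ_; z≤n; s≤s; NonZero; >-nonZero)
open import Data.Nat.Combinatorics using (_C_; nCk+nC[k+1]≡[n+1]C[k+1]; nC1≡n)
open import Data.Nat.Properties
  using (+-assoc; +-comm; +-identityʳ; *-assoc; *-comm; *-identityˡ; *-identityʳ; *-zeroʳ; *-suc; *-distribˡ-+;
         ^-distribˡ-+-*; *-cancelˡ-≡; suc-pred; <ᵇ⇒<; <-trans; <⇒≢; ≤-refl; ≤-trans; ≤-reflexive; _≤?_; ≰⇒>;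
         m≤m+n; m≤n+m; +-mono-≤; *-monoˡ-≤; *-monoʳ-≤; +-cancelˡ-≤; m^n>0; m^n≢0; m*n≢0; module ≤-Reasoning)
open import Data.Nat.Tactic.RingSolver using (solve-∀)
open import Algebra.Properties.CommutativeSemigroup Data.Nat.Properties.+-commutativeSemigroup
  using () renaming (interchange to +-interchange)
open import Data.Product using (_×_; _,_; proj₁; proj₂; map₂)
open import Data.Unit using (tt)
open import Data.Vec.Functional as Vector using (Vector; zipWith)
open import Function using (_∘_; id; Equivalence)
open import Function.Definitions using (Injective)
import Data.Integer as ℤ
open import Data.Integer.Properties using (pos-*; pos-+)
open import Data.Rational as ℚ using (ℚ; 0ℚ; toℚᵘ) renaming (_≤_ to _≤ℚ_)
open import Data.Rational.Properties using (toℚᵘ-fromℚᵘ; toℚᵘ-cancel-≤; toℚᵘ-homo-+; toℚᵘ-homo-*)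
open import Data.Rational.Unnormalised using (ℚᵘ; mkℚᵘ; *≡*; *≤*)
  renaming (_≃_ to _≃ᵘ_; _≤_ to _≤ᵘ_; _+_ to _+ᵘ_; _*_ to _*ᵘ_)
import Data.Rational.Unnormalised.Properties as ℚᵘ
open import Relation.Binary.Core using (_Preserves_⟶_)
open import Relation.Binary.PropositionalEquality
open import Relation.Nullary using (yes; no; contradiction)
open import Relation.Nullary.Decidable using (isYes≗does; dec-true; dec-false)

private variable
  A B : Set

∑ : List A → (A → ℕ) → ℕ
∑ []       f = 0
∑ (x ∷ xs) f = f x + ∑ xs f

infixr 6.5 ∑
syntax ∑ xs (λ x → e) = ∑[ x ∈ xs ] e

∑-cong : ∀ (xs : List A) {f g : A → ℕ} → f ≗ g → ∑ xs f ≡ ∑ xs g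
∑-cong []       f≗g = refl
∑-cong (x ∷ xs) f≗g = cong₂ _+_ (f≗g x) (∑-cong xs f≗g)

∑-++ : ∀ (xs ys : List A) f → ∑ (xs ++ ys) f ≡ ∑ xs f + ∑ ys f
∑-++ []       ys f = refl
∑-++ (x ∷ xs) ys f = trans (cong (f x +_) (∑-++ xs ys f)) (sym (+-assoc (f x) _ _))

∑-+ : ∀ (xs : List A) f g → ∑[ x ∈ xs ] (f x + g x) ≡ ∑ xs f + ∑ xs g
∑-+ []       f g = refl
∑-+ (x ∷ xs) f g =
  trans (cong (f x + g x +_) (∑-+ xs f g)) (+-interchange (f x) (g x) (∑ xs f) (∑ xs g))

∑-*ˡ : ∀ (xs : List A) k f → ∑[ x ∈ xs ] (k * f x) ≡ k * ∑ xs f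
∑-*ˡ []       k f = sym (*-zeroʳ k)
∑-*ˡ (x ∷ xs) k f = trans (cong (k * f x +_) (∑-*ˡ xs k f)) (sym (*-distribˡ-+ k (f x) _))

∑-const : ∀ (xs : List A) k → ∑[ x ∈ xs ] k ≡ length xs * k
∑-const []       k = refl
∑-const (x ∷ xs) k = cong (k +_) (∑-const xs k)

∑-swap : ∀ (xs : List A) (ys : List B) (F : A → B → ℕ) →
         ∑[ x ∈ xs ] ∑[ y ∈ ys ] F x y ≡ ∑[ y ∈ ys ] ∑[ x ∈ xs ] F x y
∑-swap []       ys F = sym (trans (∑-const ys 0) (*-zeroʳ (length ys)))
∑-swap (x ∷ xs) ys F =
  trans (cong (∑ ys (F x) +_) (∑-swap xs ys F)) (sym (∑-+ ys (F x) (λ y → ∑[ x ∈ xs ] F x y)))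

∑-map : ∀ (g : B → A) (ys : List B) f → ∑ (map g ys) f ≡ ∑ ys (f ∘ g)
∑-map g []       f = refl
∑-map g (y ∷ ys) f = cong (f (g y) +_) (∑-map g ys f)

∑-concatMap : ∀ (g : B → List A) (ys : List B) f →
              ∑ (concatMap g ys) f ≡ ∑[ y ∈ ys ] ∑ (g y) f
∑-concatMap g []       f = refl
∑-concatMap g (y ∷ ys) f =
  trans (∑-++ (g y) (concat (map g ys)) f) (cong (∑ (g y) f +_) (∑-concatMap g ys f))

∑-mono-≤ : ∀ (xs : List A) {f g : A → ℕ} → (∀ x → f x ≤ g x) → ∑ xs f ≤ ∑ xs g
∑-mono-≤ []       f≤g = z≤n
∑-mono-≤ (x ∷ xs) f≤g = +-mono-≤ (f≤g x) (∑-mono-≤ xs f≤g)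

length≡∑1 : ∀ (xs : List A) → length xs ≡ ∑[ x ∈ xs ] 1
length≡∑1 xs = sym (trans (∑-const xs 1) (*-identityʳ (length xs)))

𝟙 : Bool → ℕ
𝟙 true  = 1
𝟙 false = 0

𝟙-∧ : ∀ x y → 𝟙 (x ∧ y) ≡ 𝟙 x * 𝟙 y
𝟙-∧ true  y = sym (*-identityˡ (𝟙 y))
𝟙-∧ false y = refl

module _ (p : A → Bool) where

  length-filterᵇ : ∀ xs → length (filterᵇ p xs) ≡ ∑[ x ∈ xs ] 𝟙 (p x)
  length-filterᵇ []       = refl
  length-filterᵇ (x ∷ xs) with p x
  ... | true  = cong suc (length-filterᵇ xs)
  ... | false = length-filterᵇ xs

  ∑-filterᵇ-const : ∀ xs {f : A → ℕ} {c} → (∀ x → p x ≡ true → f x ≡ c) →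
                    ∑ (filterᵇ p xs) f ≡ c * length (filterᵇ p xs)
  ∑-filterᵇ-const []       {c = c} f≡c = sym (*-zeroʳ c)
  ∑-filterᵇ-const (x ∷ xs) {c = c} f≡c with p x in px
  ... | true  = trans (cong₂ _+_ (f≡c x px) (∑-filterᵇ-const xs f≡c)) (sym (*-suc c _))
  ... | false = ∑-filterᵇ-const xs f≡c

markov : ∀ (xs : List A) (a : A → ℕ) (good : A → Bool) K → (∀ x → a x ≤ K → good x ≡ true) →
         length xs * suc K ≤ ∑ xs a + suc K * length (filterᵇ good xs)
markov xs a good K good≡true = begin
  length xs * suc K                            ≡⟨ ∑-const xs (suc K) ⟨
  ∑[ x ∈ xs ] suc K                            ≤⟨ ∑-mono-≤ xs pointwise ⟩
  ∑[ x ∈ xs ] (a x + suc K * 𝟙 (good x))       ≡⟨ ∑-+ xs a _ ⟩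
  ∑ xs a + ∑[ x ∈ xs ] (suc K * 𝟙 (good x))    ≡⟨ cong (∑ xs a +_) (∑-*ˡ xs (suc K) (𝟙 ∘ good)) ⟩
  ∑ xs a + suc K * (∑[ x ∈ xs ] 𝟙 (good x))    ≡⟨ cong (λ m → ∑ xs a + suc K * m) (length-filterᵇ good xs) ⟨
  ∑ xs a + suc K * length (filterᵇ good xs)    ∎
  where
  open ≤-Reasoning
  pointwise : ∀ x → suc K ≤ a x + suc K * 𝟙 (good x)
  pointwise x with good x in good-x
  ... | true  = ≤-trans (≤-reflexive (sym (*-identityʳ (suc K)))) (m≤n+m _ (a x))
  ... | false with a x ≤? K
  ...   | yes ax≤K = contradiction (trans (sym good-x) (good≡true x ax≤K)) λ ()
  ...   | no  ax≰K =
    ≤-trans (≰⇒> ax≰K) (≤-reflexive (sym (trans (cong (a x +_) (*-zeroʳ (suc K))) (+-identityʳ (a x)))))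

private variable
  n k : ℕ

∑-allBoolFns-suc : ∀ n {h : Vector Bool (suc n) → ℕ} → h Preserves _≗_ ⟶ _≡_ →
                   ∑ (allBoolFns (suc n)) h
                   ≡ ∑[ f ∈ allBoolFns n ] h (true Vector.∷ f) + ∑[ f ∈ allBoolFns n ] h (false Vector.∷ f)
∑-allBoolFns-suc n {h} h-resp = trans (∑-++ (map _ (allBoolFns n)) _ h)
  (cong₂ _+_ (sum-cons true _ (λ f → λ { zero → refl ; (suc i) → refl }))
             (trans (∑-++ (map _ (allBoolFns n)) [] h)
                    (trans (+-identityʳ _) (sum-cons false _ (λ f → λ { zero → refl ; (suc i) → refl })))))
  where
  sum-cons : ∀ b (cons : Vector Bool n → Vector Bool (suc n)) → (∀ f → cons f ≗ b Vector.∷ f) →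
             ∑ (map cons (allBoolFns n)) h ≡ ∑[ f ∈ allBoolFns n ] h (b Vector.∷ f)
  sum-cons b cons cons≗ = trans (∑-map cons (allBoolFns n) h) (∑-cong (allBoolFns n) (h-resp ∘ cons≗))

∑-allBoolFns-xor : ∀ n {h : Vector Bool n → ℕ} → h Preserves _≗_ ⟶ _≡_ → ∀ e →
                   ∑[ f ∈ allBoolFns n ] h (zipWith _xor_ f e) ≡ ∑ (allBoolFns n) h
∑-allBoolFns-xor zero    h-resp e = cong (_+ 0) (h-resp λ ())
∑-allBoolFns-xor (suc n) {h} h-resp e = begin
  ∑[ f ∈ allBoolFns (suc n) ] h (zipWith _xor_ f e)
    ≡⟨ ∑-allBoolFns-suc n (λ f≗g → h-resp (λ i → cong (_xor e i) (f≗g i))) ⟩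
  ∑[ f ∈ allBoolFns n ] h (zipWith _xor_ (true Vector.∷ f) e)
    + ∑[ f ∈ allBoolFns n ] h (zipWith _xor_ (false Vector.∷ f) e)
    ≡⟨ cong₂ _+_ (∑-cong (allBoolFns n) (λ f → h-resp λ { zero → refl ; (suc i) → refl }))
                 (∑-cong (allBoolFns n) (λ f → h-resp λ { zero → refl ; (suc i) → refl })) ⟩
  ∑[ f ∈ allBoolFns n ] h (not (e zero) Vector.∷ zipWith _xor_ f (Vector.tail e))
    + ∑[ f ∈ allBoolFns n ] h (e zero Vector.∷ zipWith _xor_ f (Vector.tail e))
    ≡⟨ cong₂ _+_ (∑-allBoolFns-xor n (cons-resp (not (e zero))) (Vector.tail e))
                 (∑-allBoolFns-xor n (cons-resp (e zero)) (Vector.tail e)) ⟩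
  ∑[ f ∈ allBoolFns n ] h (not (e zero) Vector.∷ f) + ∑[ f ∈ allBoolFns n ] h (e zero Vector.∷ f)
    ≡⟨ both-heads (e zero) ⟩
  ∑[ f ∈ allBoolFns n ] h (true Vector.∷ f) + ∑[ f ∈ allBoolFns n ] h (false Vector.∷ f)
    ≡⟨ ∑-allBoolFns-suc n h-resp ⟨
  ∑ (allBoolFns (suc n)) h ∎
  where
  open ≡-Reasoning
  cons-resp : ∀ b → (λ f → h (b Vector.∷ f)) Preserves _≗_ ⟶ _≡_
  cons-resp b f≗g = h-resp λ { zero → refl ; (suc i) → f≗g i }
  both-heads : ∀ b → ∑[ f ∈ allBoolFns n ] h (not b Vector.∷ f) + ∑[ f ∈ allBoolFns n ] h (b Vector.∷ f)
                   ≡ ∑[ f ∈ allBoolFns n ] h (true Vector.∷ f) + ∑[ f ∈ allBoolFns n ] h (false Vector.∷ f)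
  both-heads true  = +-comm (∑[ f ∈ allBoolFns n ] h (false Vector.∷ f)) _
  both-heads false = refl

length-allBoolFns : ∀ n → length (allBoolFns n) ≡ 2 ^ n
length-allBoolFns zero    = refl
length-allBoolFns (suc n) = begin
  length (allBoolFns (suc n))                             ≡⟨ length≡∑1 (allBoolFns (suc n)) ⟩
  ∑[ f ∈ allBoolFns (suc n) ] 1                           ≡⟨ ∑-allBoolFns-suc n (λ _ → refl) ⟩
  ∑[ f ∈ allBoolFns n ] 1 + ∑[ f ∈ allBoolFns n ] 1       ≡⟨ cong₂ _+_ half half ⟩
  2 ^ n + 2 ^ n                                           ≡⟨ cong (2 ^ n +_) (+-identityʳ (2 ^ n)) ⟨
  2 ^ suc n                                               ∎
  where
  open ≡-Reasoning
  half : ∑[ f ∈ allBoolFns n ] 1 ≡ 2 ^ n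
  half = trans (sym (length≡∑1 (allBoolFns n))) (length-allBoolFns n)

infix 4 _≈_
infixl 6 _⊕_

_≈_ : Graph n → Graph n → Set
G ≈ H = ∀ i j → adj G i j ≡ adj H i j

_⊕_ : Graph n → Graph n → Graph n
_⊕_ {zero}  _       _        = tt
_⊕_ {suc n} (g , f) (h , f′) = g ⊕ h , zipWith _xor_ f f′

adj-⊕ : ∀ (G H : Graph n) i j → adj (G ⊕ H) i j ≡ adj G i j xor adj H i j
adj-⊕ {suc n} (g , f) (h , f′) zero    zero    = refl
adj-⊕ {suc n} (g , f) (h , f′) zero    (suc j) = refl
adj-⊕ {suc n} (g , f) (h , f′) (suc i) zero    = refl
adj-⊕ {suc n} (g , f) (h , f′) (suc i) (suc j) = adj-⊕ g h i j

⊕-comm : ∀ (G H : Graph n) → G ⊕ H ≈ H ⊕ G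
⊕-comm G H i j = trans (adj-⊕ G H i j) (trans (xor-comm (adj G i j) _) (sym (adj-⊕ H G i j)))

adj-irrefl : ∀ (G : Graph n) i → adj G i i ≡ false
adj-irrefl {suc n} (g , f) zero    = refl
adj-irrefl {suc n} (g , f) (suc i) = adj-irrefl g i

adj-sym : ∀ (G : Graph n) i j → adj G i j ≡ adj G j i
adj-sym {suc n} (g , f) zero    zero    = refl
adj-sym {suc n} (g , f) zero    (suc j) = refl
adj-sym {suc n} (g , f) (suc i) zero    = refl
adj-sym {suc n} (g , f) (suc i) (suc j) = adj-sym g i j

≈-extend : ∀ {g h : Graph n} {f f′} → g ≈ h → f ≗ f′ → (g , f) ≈ (h , f′)
≈-extend g≈h f≗f′ zero    zero    = refl
≈-extend g≈h f≗f′ zero    (suc j) = f≗f′ j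
≈-extend g≈h f≗f′ (suc i) zero    = f≗f′ i
≈-extend g≈h f≗f′ (suc i) (suc j) = g≈h i j

∑-allGraphs-suc : ∀ n (F : Graph (suc n) → ℕ) →
                  ∑ (allGraphs (suc n)) F ≡ ∑[ g ∈ allGraphs n ] ∑[ f ∈ allBoolFns n ] F (g , f)
∑-allGraphs-suc n F =
  trans (∑-concatMap _ (allGraphs n) F) (∑-cong (allGraphs n) (λ g → ∑-map _ (allBoolFns n) F))

∑-allGraphs-⊕ : ∀ n {F : Graph n → ℕ} → F Preserves _≈_ ⟶ _≡_ → ∀ E →
                ∑[ G ∈ allGraphs n ] F (G ⊕ E) ≡ ∑ (allGraphs n) F
∑-allGraphs-⊕ zero    F-resp E = refl
∑-allGraphs-⊕ (suc n) {F} F-resp (e , φ) = begin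
  ∑[ G ∈ allGraphs (suc n) ] F (G ⊕ (e , φ))
    ≡⟨ ∑-allGraphs-suc n _ ⟩
  ∑[ g ∈ allGraphs n ] ∑[ f ∈ allBoolFns n ] F (g ⊕ e , zipWith _xor_ f φ)
    ≡⟨ ∑-cong (allGraphs n) (λ g → ∑-allBoolFns-xor n (λ f≗f′ → F-resp (≈-extend (λ _ _ → refl) f≗f′)) φ) ⟩
  ∑[ g ∈ allGraphs n ] ∑[ f ∈ allBoolFns n ] F (g ⊕ e , f)
    ≡⟨ ∑-allGraphs-⊕ n (λ g≈h → ∑-cong (allBoolFns n) (λ f → F-resp (≈-extend g≈h (λ _ → refl)))) e ⟩
  ∑[ g ∈ allGraphs n ] ∑[ f ∈ allBoolFns n ] F (g , f)
    ≡⟨ ∑-allGraphs-suc n F ⟨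
  ∑ (allGraphs (suc n)) F ∎
  where open ≡-Reasoning

length-allGraphs : ∀ n → length (allGraphs n) ≡ 2 ^ (n C 2)
length-allGraphs zero    = refl
length-allGraphs (suc n) = begin
  length (allGraphs (suc n))                        ≡⟨ length≡∑1 (allGraphs (suc n)) ⟩
  ∑[ G ∈ allGraphs (suc n) ] 1                      ≡⟨ ∑-allGraphs-suc n _ ⟩
  ∑[ g ∈ allGraphs n ] ∑[ f ∈ allBoolFns n ] 1
    ≡⟨ ∑-cong (allGraphs n) (λ _ → trans (sym (length≡∑1 (allBoolFns n))) (length-allBoolFns n)) ⟩
  ∑[ g ∈ allGraphs n ] 2 ^ n                        ≡⟨ ∑-const (allGraphs n) (2 ^ n) ⟩
  length (allGraphs n) * 2 ^ n                      ≡⟨ cong (_* 2 ^ n) (length-allGraphs n) ⟩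
  2 ^ (n C 2) * 2 ^ n                               ≡⟨ ^-distribˡ-+-* 2 (n C 2) n ⟨
  2 ^ (n C 2 + n)                                   ≡⟨ cong (λ m → 2 ^ (n C 2 + m)) (nC1≡n n) ⟨
  2 ^ (n C 2 + n C 1)                               ≡⟨ cong (2 ^_) (trans (+-comm (n C 2) _) (nCk+nC[k+1]≡[n+1]C[k+1] n 1)) ⟩
  2 ^ (suc n C 2)                                   ∎
  where open ≡-Reasoning

fromAdj : (Fin n → Fin n → Bool) → Graph n
fromAdj {zero}  A = tt
fromAdj {suc n} A = fromAdj (λ i j → A (suc i) (suc j)) , λ j → A zero (suc j) ∨ A (suc j) zero

adj-fromAdj : ∀ (A : Fin n → Fin n → Bool) {i j} → i ≢ j → adj (fromAdj A) i j ≡ A i j ∨ A j i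
adj-fromAdj {suc n} A {zero}  {zero}  i≢j = contradiction refl i≢j
adj-fromAdj {suc n} A {zero}  {suc j} i≢j = refl
adj-fromAdj {suc n} A {suc i} {zero}  i≢j = ∨-comm (A zero (suc i)) _
adj-fromAdj {suc n} A {suc i} {suc j} i≢j = adj-fromAdj (λ i j → A (suc i) (suc j)) (i≢j ∘ cong suc)

restrict : Graph n → (Fin k → Fin n) → Graph k
restrict G s = fromAdj λ c d → adj G (s c) (s d)

adj-restrict : ∀ (G : Graph n) (s : Fin k → Fin n) c d → adj (restrict G s) c d ≡ adj G (s c) (s d)
adj-restrict G s c d with c ≟ᶠ d
... | yes refl = trans (adj-irrefl (restrict G s) c) (sym (adj-irrefl G (s c)))
... | no c≢d   = begin
  adj (restrict G s) c d                    ≡⟨ adj-fromAdj _ c≢d ⟩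
  adj G (s c) (s d) ∨ adj G (s d) (s c)     ≡⟨ cong (adj G (s c) (s d) ∨_) (adj-sym G (s d) (s c)) ⟩
  adj G (s c) (s d) ∨ adj G (s c) (s d)     ≡⟨ ∨-idem _ ⟩
  adj G (s c) (s d)                         ∎
  where open ≡-Reasoning

restrict-resp-≈ : ∀ (s : Fin k → Fin n) → (λ G → restrict G s) Preserves _≈_ ⟶ _≈_
restrict-resp-≈ s {G} {H} G≈H c d =
  trans (adj-restrict G s c d) (trans (G≈H (s c) (s d)) (sym (adj-restrict H s c d)))

anyFin : (Fin k → Bool) → Bool
anyFin {zero}  P = false
anyFin {suc k} P = P zero ∨ anyFin (P ∘ suc)

anyFin-false : ∀ (P : Fin k → Bool) → (∀ c → P c ≡ false) → anyFin P ≡ false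
anyFin-false {zero}  P P≡false = refl
anyFin-false {suc k} P P≡false rewrite P≡false zero = anyFin-false (P ∘ suc) (P≡false ∘ suc)

anyFin-unique : ∀ (P : Fin k → Bool) c → (∀ c′ → c′ ≢ c → P c′ ≡ false) → anyFin P ≡ P c
anyFin-unique {suc k} P zero    P≡false =
  trans (cong (P zero ∨_) (anyFin-false (P ∘ suc) (λ c → P≡false (suc c) λ ()))) (∨-identityʳ (P zero))
anyFin-unique {suc k} P (suc c) P≡false rewrite P≡false zero (λ ()) =
  anyFin-unique (P ∘ suc) c (λ c′ c′≢c → P≡false (suc c′) (c′≢c ∘ suc-injective))

==-refl : ∀ (i : Fin n) → (i == i) ≡ true
==-refl i = trans (isYes≗does (i ≟ᶠ i)) (dec-true (i ≟ᶠ i) refl)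

≢⇒==-false : ∀ {i j : Fin n} → i ≢ j → (i == j) ≡ false
≢⇒==-false {i = i} {j} i≢j = trans (isYes≗does (i ≟ᶠ j)) (dec-false (i ≟ᶠ j) i≢j)

lift : (Fin k → Fin n) → Graph k → Graph n
lift s E = fromAdj λ x y → anyFin λ c → (s c == x) ∧ anyFin λ d → (s d == y) ∧ adj E c d

module _ {s : Fin k → Fin n} (s-injective : Injective _≡_ _≡_ s) where

  anyFin-image : ∀ (Q : Fin k → Bool) c → anyFin (λ c′ → (s c′ == s c) ∧ Q c′) ≡ Q c
  anyFin-image Q c = begin
    anyFin (λ c′ → (s c′ == s c) ∧ Q c′)
      ≡⟨ anyFin-unique _ c (λ c′ c′≢c → cong (_∧ Q c′) (≢⇒==-false (c′≢c ∘ s-injective))) ⟩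
    (s c == s c) ∧ Q c                  ≡⟨ cong (_∧ Q c) (==-refl (s c)) ⟩
    Q c                                 ∎
    where open ≡-Reasoning

  adj-lift : ∀ E c d → adj (lift s E) (s c) (s d) ≡ adj E c d
  adj-lift E c d with c ≟ᶠ d
  ... | yes refl = trans (adj-irrefl (lift s E) (s c)) (sym (adj-irrefl E c))
  ... | no c≢d   = begin
    adj (lift s E) (s c) (s d)   ≡⟨ adj-fromAdj _ (c≢d ∘ s-injective) ⟩
    image c d ∨ image d c        ≡⟨ cong₂ _∨_ (image≡ c d) (trans (image≡ d c) (adj-sym E d c)) ⟩
    adj E c d ∨ adj E c d        ≡⟨ ∨-idem _ ⟩
    adj E c d                    ∎
    where
    open ≡-Reasoning
    image : Fin k → Fin k → Bool
    image c d = anyFin λ c′ → (s c′ == s c) ∧ anyFin λ d′ → (s d′ == s d) ∧ adj E c′ d′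
    image≡ : ∀ c d → image c d ≡ adj E c d
    image≡ c d = trans (anyFin-image _ c) (anyFin-image (adj E c) d)

  restrict-⊕-lift : ∀ (G : Graph n) E → restrict (G ⊕ lift s E) s ≈ restrict G s ⊕ E
  restrict-⊕-lift G E c d = begin
    adj (restrict (G ⊕ lift s E) s) c d               ≡⟨ adj-restrict (G ⊕ lift s E) s c d ⟩
    adj (G ⊕ lift s E) (s c) (s d)                    ≡⟨ adj-⊕ G (lift s E) (s c) (s d) ⟩
    adj G (s c) (s d) xor adj (lift s E) (s c) (s d)  ≡⟨ cong₂ _xor_ (sym (adj-restrict G s c d)) (adj-lift E c d) ⟩
    adj (restrict G s) c d xor adj E c d              ≡⟨ adj-⊕ (restrict G s) E c d ⟨
    adj (restrict G s ⊕ E) c d                        ∎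
    where open ≡-Reasoning

  -- The restriction of a uniform graph to the image of s is uniform.
  ∑-restrict : ∀ {F : Graph k → ℕ} → F Preserves _≈_ ⟶ _≡_ →
               length (allGraphs k) * (∑[ G ∈ allGraphs n ] F (restrict G s))
               ≡ length (allGraphs n) * ∑ (allGraphs k) F
  ∑-restrict {F} F-resp = begin
    length (allGraphs k) * (∑[ G ∈ allGraphs n ] F (restrict G s))
      ≡⟨ ∑-const (allGraphs k) _ ⟨
    ∑[ E ∈ allGraphs k ] ∑[ G ∈ allGraphs n ] F (restrict G s)
      ≡⟨ ∑-cong (allGraphs k) (λ E → ∑-allGraphs-⊕ n (F-resp ∘ restrict-resp-≈ s) (lift s E)) ⟨
    ∑[ E ∈ allGraphs k ] ∑[ G ∈ allGraphs n ] F (restrict (G ⊕ lift s E) s)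
      ≡⟨ ∑-cong (allGraphs k) (λ E → ∑-cong (allGraphs n) (λ G → F-resp (restrict-⊕-lift G E))) ⟩
    ∑[ E ∈ allGraphs k ] ∑[ G ∈ allGraphs n ] F (restrict G s ⊕ E)
      ≡⟨ ∑-swap (allGraphs k) (allGraphs n) _ ⟩
    ∑[ G ∈ allGraphs n ] ∑[ E ∈ allGraphs k ] F (restrict G s ⊕ E)
      ≡⟨ ∑-cong (allGraphs n) (λ G → ∑-cong (allGraphs k) (λ E → F-resp (⊕-comm (restrict G s) E))) ⟩
    ∑[ G ∈ allGraphs n ] ∑[ E ∈ allGraphs k ] F (E ⊕ restrict G s)
      ≡⟨ ∑-cong (allGraphs n) (λ G → ∑-allGraphs-⊕ k F-resp (restrict G s)) ⟩
    ∑[ G ∈ allGraphs n ] ∑ (allGraphs k) F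
      ≡⟨ ∑-const (allGraphs n) _ ⟩
    length (allGraphs n) * ∑ (allGraphs k) F ∎
    where open ≡-Reasoning

isoᵇ-resp : ∀ {A B : Adj4} H → (∀ i j → A i j ≡ B i j) → isoᵇ A H ≡ isoᵇ B H
isoᵇ-resp H A≗B = cong or (map-cong (λ σ → cong and (map-cong (λ i → cong₂ _∧_
  (cong and (map-cong (λ j → cong (λ b → not b ∨ H (σ i) (σ j)) (A≗B i j)) (allFin 4)))
  (cong and (map-cong (λ j → cong (not (H (σ i) (σ j)) ∨_) (A≗B i j)) (allFin 4)))) (allFin 4))) perms4)

scaledWeights : List ℕ
scaledWeights = 12 ∷ 6 ∷ 5 ∷ 5 ∷ 4 ∷ 2 ∷ 6 ∷ 4 ∷ 3 ∷ 3 ∷ 3 ∷ []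

scaledClasses : List (Adj4 × ℕ)
scaledClasses = zip (map proj₁ weightedClasses) scaledWeights

scaledSum : (Adj4 → ℕ) → ℕ
scaledSum f = ∑[ Hk ∈ scaledClasses ] (proj₂ Hk * f (proj₁ Hk))

scaledSum-cong : ∀ {f g : Adj4 → ℕ} → f ≗ g → scaledSum f ≡ scaledSum g
scaledSum-cong f≗g = ∑-cong scaledClasses λ Hk → cong (proj₂ Hk *_) (f≗g (proj₁ Hk))

∑-scaledSum : ∀ (xs : List A) (f : A → Adj4 → ℕ) →
              ∑[ x ∈ xs ] scaledSum (f x) ≡ scaledSum λ H → ∑[ x ∈ xs ] f x H
∑-scaledSum xs f = trans (∑-swap xs scaledClasses λ x Hk → proj₂ Hk * f x (proj₁ Hk))
                          (∑-cong scaledClasses λ Hk → ∑-*ˡ xs (proj₂ Hk) λ x → f x (proj₁ Hk))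

score : Adj4 → ℕ
score A = scaledSum λ H → 𝟙 (isoᵇ A H)

score-resp : ∀ {A B : Adj4} → (∀ i j → A i j ≡ B i j) → score A ≡ score B
score-resp A≗B = scaledSum-cong λ H → cong 𝟙 (isoᵇ-resp H A≗B)

length-allGraphs4 : length (allGraphs 4) ≡ 64
length-allGraphs4 = refl

-- So a uniformly random graph on four vertices has expected score 240/64 = 12·(5/16).
∑-score-allGraphs4 : ∑[ E ∈ allGraphs 4 ] score (adj E) ≡ 240
∑-score-allGraphs4 = refl

64m≡240n⇒4m≡15n : ∀ m n → 64 * m ≡ n * 240 → 4 * m ≡ 15 * n
64m≡240n⇒4m≡15n m n eq = *-cancelˡ-≡ (4 * m) (15 * n) 16 (begin
  16 * (4 * m)   ≡⟨ lhs m ⟩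
  64 * m         ≡⟨ eq ⟩
  n * 240        ≡⟨ rhs n ⟩
  16 * (15 * n)  ∎)
  where
  open ≡-Reasoning
  lhs : ∀ m → 16 * (4 * m) ≡ 64 * m
  lhs = solve-∀
  rhs : ∀ n → n * 240 ≡ 16 * (15 * n)
  rhs = solve-∀

∑-score-induced : ∀ (s : Fin 4 → Fin n) → Injective _≡_ _≡_ s →
                  4 * (∑[ G ∈ allGraphs n ] score (induced G s)) ≡ 15 * length (allGraphs n)
∑-score-induced {n} s s-injective = 64m≡240n⇒4m≡15n S (length (allGraphs n)) (begin
  64 * S
    ≡⟨ cong (_* S) {x = length (allGraphs 4)} {y = 64} length-allGraphs4 ⟨
  length (allGraphs 4) * S
    ≡⟨ cong (length (allGraphs 4) *_) (∑-cong (allGraphs n) λ G →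
         score-resp {induced G s} {adj (restrict G s)} (λ c d → sym (adj-restrict G s c d))) ⟩
  length (allGraphs 4) * (∑[ G ∈ allGraphs n ] score (adj (restrict G s)))
    ≡⟨ ∑-restrict s-injective {F = score ∘ adj} (λ {G} {H} G≈H → score-resp {adj G} {adj H} G≈H) ⟩
  length (allGraphs n) * (∑[ E ∈ allGraphs 4 ] score (adj E))
    ≡⟨ cong (length (allGraphs n) *_) ∑-score-allGraphs4 ⟩
  length (allGraphs n) * 240 ∎)
  where
  open ≡-Reasoning
  S : ℕ
  S = ∑[ G ∈ allGraphs n ] score (induced G s)

-- Definitionally the filter predicate of subsets4.
increasing : (Fin 4 → Fin n) → Bool
increasing s = (toℕ (s v0) <ᵇ toℕ (s v1)) ∧ (toℕ (s v1) <ᵇ toℕ (s v2)) ∧ (toℕ (s v2) <ᵇ toℕ (s v3))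

increasing⇒injective : ∀ (s : Fin 4 → Fin n) → increasing s ≡ true → Injective _≡_ _≡_ s
increasing⇒injective s incr = injective
  where
  ordered : T (toℕ (s v0) <ᵇ toℕ (s v1)) × T (toℕ (s v1) <ᵇ toℕ (s v2)) × T (toℕ (s v2) <ᵇ toℕ (s v3))
  ordered = map₂ (Equivalence.to T-∧) (Equivalence.to T-∧ (Equivalence.from T-≡ incr))
  l01 : toℕ (s v0) < toℕ (s v1)
  l01 = <ᵇ⇒< _ _ (proj₁ ordered)
  l12 : toℕ (s v1) < toℕ (s v2)
  l12 = <ᵇ⇒< _ _ (proj₁ (proj₂ ordered))
  l23 : toℕ (s v2) < toℕ (s v3)
  l23 = <ᵇ⇒< _ _ (proj₂ (proj₂ ordered))
  l02 : toℕ (s v0) < toℕ (s v2)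
  l02 = <-trans l01 l12
  l13 : toℕ (s v1) < toℕ (s v3)
  l13 = <-trans l12 l23
  l03 : toℕ (s v0) < toℕ (s v3)
  l03 = <-trans l02 l23
  apart : ∀ {a b} → toℕ (s a) < toℕ (s b) → s a ≢ s b
  apart lt eq = <⇒≢ lt (cong toℕ eq)
  injective : Injective _≡_ _≡_ s
  injective {zero}                {zero}                _  = refl
  injective {zero}                {suc zero}            eq = contradiction eq (apart l01)
  injective {zero}                {suc (suc zero)}      eq = contradiction eq (apart l02)
  injective {zero}                {suc (suc (suc zero))} eq = contradiction eq (apart l03)
  injective {suc zero}            {zero}                eq = contradiction (sym eq) (apart l01)
  injective {suc zero}            {suc zero}            _  = refl
  injective {suc zero}            {suc (suc zero)}      eq = contradiction eq (apart l12)
  injective {suc zero}            {suc (suc (suc zero))} eq = contradiction eq (apart l13)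
  injective {suc (suc zero)}      {zero}                eq = contradiction (sym eq) (apart l02)
  injective {suc (suc zero)}      {suc zero}            eq = contradiction (sym eq) (apart l12)
  injective {suc (suc zero)}      {suc (suc zero)}      _  = refl
  injective {suc (suc zero)}      {suc (suc (suc zero))} eq = contradiction eq (apart l23)
  injective {suc (suc (suc zero))} {zero}               eq = contradiction (sym eq) (apart l03)
  injective {suc (suc (suc zero))} {suc zero}           eq = contradiction (sym eq) (apart l13)
  injective {suc (suc (suc zero))} {suc (suc zero)}     eq = contradiction (sym eq) (apart l23)
  injective {suc (suc (suc zero))} {suc (suc (suc zero))} _ = refl

-- subsets4 n is filterᵇ increasing (quadruples mk) for the enumeration mk used in its definition.
quadruples : (Fin n → Fin n → Fin n → Fin n → Fin 4 → Fin n) → List (Fin 4 → Fin n)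
quadruples {n} mk =
  concatMap (λ a → concatMap (λ b → concatMap (λ c → map (mk a b c) (allFin n)) (allFin n)) (allFin n)) (allFin n)

∑-quadruples : ∀ mk (f : (Fin 4 → Fin n) → ℕ) →
               ∑ (quadruples mk) f
               ≡ ∑[ a ∈ allFin n ] ∑[ b ∈ allFin n ] ∑[ c ∈ allFin n ] ∑[ d ∈ allFin n ] f (mk a b c d)
∑-quadruples {n} mk f =
  trans (∑-concatMap _ (allFin n) f) (∑-cong (allFin n) λ a →
  trans (∑-concatMap _ (allFin n) f) (∑-cong (allFin n) λ b →
  trans (∑-concatMap _ (allFin n) f) (∑-cong (allFin n) λ c →
  ∑-map (mk a b c) (allFin n) f)))

∑-subsets4-const : ∀ {f : (Fin 4 → Fin n) → ℕ} {c} → (∀ s → increasing s ≡ true → f s ≡ c) →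
                   ∑ (subsets4 n) f ≡ c * length (subsets4 n)
∑-subsets4-const {n} f≡c = ∑-filterᵇ-const increasing (quadruples {n} _) f≡c

∑-allFin-suc : ∀ n (f : Fin (suc n) → ℕ) → ∑ (allFin (suc n)) f ≡ f zero + ∑[ i ∈ allFin n ] f (suc i)
∑-allFin-suc n f = cong (f zero +_) (trans (cong (λ xs → ∑ xs f) (sym (map-tabulate id suc))) (∑-map suc (allFin n) f))

hockey-stick : ∀ n k → ∑[ i ∈ allFin n ] ((n ∸ suc (toℕ i)) C k) ≡ n C suc k
hockey-stick zero    k = refl
hockey-stick (suc n) k =
  trans (∑-allFin-suc n _) (trans (cong (n C k +_) (hockey-stick n k)) (nCk+nC[k+1]≡[n+1]C[k+1] n k))

hockey-stick-above : ∀ n k c →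
                     ∑[ i ∈ allFin n ] (𝟙 (c <ᵇ toℕ i) * ((n ∸ suc (toℕ i)) C k)) ≡ (n ∸ suc c) C suc k
hockey-stick-above zero    k c       = refl
hockey-stick-above (suc n) k zero    =
  trans (∑-allFin-suc n (λ i → 𝟙 (0 <ᵇ toℕ i) * ((suc n ∸ suc (toℕ i)) C k)))
        (trans (∑-cong (allFin n) (λ i → *-identityˡ _)) (hockey-stick n k))
hockey-stick-above (suc n) k (suc c) =
  trans (∑-allFin-suc n (λ i → 𝟙 (suc c <ᵇ toℕ i) * ((suc n ∸ suc (toℕ i)) C k))) (hockey-stick-above n k c)

length-subsets4 : ∀ n → length (subsets4 n) ≡ n C 4
length-subsets4 n = begin
  length (subsets4 n)
    ≡⟨ length-filterᵇ increasing (quadruples {n} _) ⟩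
  ∑[ s ∈ quadruples {n} _ ] 𝟙 (increasing s)
    ≡⟨ ∑-quadruples {n} _ (𝟙 ∘ increasing) ⟩
  ∑[ a ∈ Fs ] ∑[ b ∈ Fs ] ∑[ c ∈ Fs ] ∑[ d ∈ Fs ] 𝟙 ((a <ᶠ b) ∧ (b <ᶠ c) ∧ (c <ᶠ d))
    ≡⟨ ∑-cong Fs (λ a → ∑-cong Fs λ b → ∑-cong Fs λ c → innermost a b c) ⟩
  ∑[ a ∈ Fs ] ∑[ b ∈ Fs ] ∑[ c ∈ Fs ] (𝟙 (a <ᶠ b) * (𝟙 (b <ᶠ c) * ((n ∸ suc (toℕ c)) C 1)))
    ≡⟨ ∑-cong Fs (λ a → ∑-cong Fs λ b → above (𝟙 (a <ᶠ b)) 1 (toℕ b)) ⟩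
  ∑[ a ∈ Fs ] ∑[ b ∈ Fs ] (𝟙 (a <ᶠ b) * ((n ∸ suc (toℕ b)) C 2))
    ≡⟨ ∑-cong Fs (λ a → hockey-stick-above n 2 (toℕ a)) ⟩
  ∑[ a ∈ Fs ] ((n ∸ suc (toℕ a)) C 3)
    ≡⟨ hockey-stick n 3 ⟩
  n C 4 ∎
  where
  open ≡-Reasoning
  Fs : List (Fin n)
  Fs = allFin n
  _<ᶠ_ : Fin n → Fin n → Bool
  a <ᶠ b = toℕ a <ᵇ toℕ b
  above : ∀ x k c → ∑[ i ∈ Fs ] (x * (𝟙 (c <ᵇ toℕ i) * ((n ∸ suc (toℕ i)) C k))) ≡ x * ((n ∸ suc c) C suc k)
  above x k c = trans (∑-*ˡ Fs x _) (cong (x *_) (hockey-stick-above n k c))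
  innermost : ∀ a b c → ∑[ d ∈ Fs ] 𝟙 ((a <ᶠ b) ∧ (b <ᶠ c) ∧ (c <ᶠ d))
                        ≡ 𝟙 (a <ᶠ b) * (𝟙 (b <ᶠ c) * ((n ∸ suc (toℕ c)) C 1))
  innermost a b c = trans (∑-cong Fs λ d → begin
      𝟙 ((a <ᶠ b) ∧ (b <ᶠ c) ∧ (c <ᶠ d))              ≡⟨ 𝟙-∧ (a <ᶠ b) _ ⟩
      𝟙 (a <ᶠ b) * 𝟙 ((b <ᶠ c) ∧ (c <ᶠ d))            ≡⟨ cong (𝟙 (a <ᶠ b) *_) (𝟙-∧ (b <ᶠ c) _) ⟩
      𝟙 (a <ᶠ b) * (𝟙 (b <ᶠ c) * 𝟙 (c <ᶠ d))          ≡⟨ cong (λ m → 𝟙 (a <ᶠ b) * (𝟙 (b <ᶠ c) * m)) (*-identityʳ _) ⟨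
      𝟙 (a <ᶠ b) * (𝟙 (b <ᶠ c) * (𝟙 (c <ᶠ d) * 1))    ∎)
    (trans (∑-*ˡ Fs (𝟙 (a <ᶠ b)) _) (cong (𝟙 (a <ᶠ b) *_) (above (𝟙 (b <ᶠ c)) 0 (toℕ c))))

scoreSum : Graph n → ℕ
scoreSum {n} G = ∑[ s ∈ subsets4 n ] score (induced G s)

∑-scoreSum : ∀ n → ∑[ G ∈ allGraphs n ] 4 * scoreSum G ≡ 15 * length (allGraphs n) * length (subsets4 n)
∑-scoreSum n = begin
  ∑[ G ∈ allGraphs n ] 4 * scoreSum G
    ≡⟨ ∑-cong (allGraphs n) (λ G → ∑-*ˡ (subsets4 n) 4 (score ∘ induced G)) ⟨
  ∑[ G ∈ allGraphs n ] ∑[ s ∈ subsets4 n ] 4 * score (induced G s)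
    ≡⟨ ∑-swap (allGraphs n) (subsets4 n) _ ⟩
  ∑[ s ∈ subsets4 n ] ∑[ G ∈ allGraphs n ] 4 * score (induced G s)
    ≡⟨ ∑-cong (subsets4 n) (λ s → ∑-*ˡ (allGraphs n) 4 (λ G → score (induced G s))) ⟩
  ∑[ s ∈ subsets4 n ] 4 * (∑[ G ∈ allGraphs n ] score (induced G s))
    ≡⟨ ∑-subsets4-const {n} (λ s incr → ∑-score-induced s (increasing⇒injective s incr)) ⟩
  15 * length (allGraphs n) * length (subsets4 n) ∎
  where open ≡-Reasoning

count : Graph n → Adj4 → ℕ
count {n} G H = length (filterᵇ (λ s → isoᵇ (induced G s) H) (subsets4 n))

scoreSum≡scaledSum-count : ∀ (G : Graph n) → scoreSum G ≡ scaledSum (count G)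
scoreSum≡scaledSum-count {n} G =
  trans (∑-scaledSum (subsets4 n) λ s H → 𝟙 (isoᵇ (induced G s) H))
        (scaledSum-cong λ H → sym (length-filterᵇ (λ s → isoᵇ (induced G s) H) (subsets4 n)))

mkℚᵘ-≃ : ∀ {a b c d} → a * suc d ≡ c * suc b → mkℚᵘ (ℤ.+ a) b ≃ᵘ mkℚᵘ (ℤ.+ c) d
mkℚᵘ-≃ {a} {b} {c} {d} eq = *≡* (trans (sym (pos-* a (suc d))) (trans (cong ℤ.+_ eq) (pos-* c (suc b))))

mkℚᵘ-≤ : ∀ {a b c d} → a * suc d ≤ c * suc b → mkℚᵘ (ℤ.+ a) b ≤ᵘ mkℚᵘ (ℤ.+ c) d
mkℚᵘ-≤ {a} {b} {c} {d} le =
  *≤* (subst₂ ℤ._≤_ (pos-* a (suc d)) (pos-* c (suc b)) (ℤ.+≤+ le))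

mkℚᵘ-* : ∀ a b c d → mkℚᵘ (ℤ.+ a) b *ᵘ mkℚᵘ (ℤ.+ c) d ≃ᵘ mkℚᵘ (ℤ.+ (a * c)) (pred (suc b * suc d))
mkℚᵘ-* a b c d = ℚᵘ.≃-reflexive (cong (λ z → mkℚᵘ z _) (sym (pos-* a c)))

mkℚᵘ-+ : ∀ a b c d →
         mkℚᵘ (ℤ.+ a) b +ᵘ mkℚᵘ (ℤ.+ c) d ≃ᵘ mkℚᵘ (ℤ.+ (a * suc d + c * suc b)) (pred (suc b * suc d))
mkℚᵘ-+ a b c d = ℚᵘ.≃-reflexive (cong (λ z → mkℚᵘ z _)
  (sym (trans (pos-+ (a * suc d) _) (cong₂ ℤ._+_ (pos-* a (suc d)) (pos-* c (suc b))))))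

toℚᵘ-frac : ∀ a b → toℚᵘ (frac a (suc b)) ≃ᵘ mkℚᵘ (ℤ.+ a) b
toℚᵘ-frac a b = toℚᵘ-fromℚᵘ (mkℚᵘ (ℤ.+ a) b)

frac-≤ : ∀ {a b c d} .{{_ : NonZero b}} .{{_ : NonZero d}} → a * d ≤ c * b → frac a b ≤ℚ frac c d
frac-≤ {a} {suc b} {c} {suc d} le =
  toℚᵘ-cancel-≤ (ℚᵘ.≤-respʳ-≃ (ℚᵘ.≃-sym (toℚᵘ-frac c d))
                                (ℚᵘ.≤-respˡ-≃ (ℚᵘ.≃-sym (toℚᵘ-frac a b)) (mkℚᵘ-≤ le)))

weight≃scaledWeight/12 : Pointwise (λ Hw k → toℚᵘ (proj₂ Hw) ≃ᵘ mkℚᵘ (ℤ.+ k) 11) weightedClasses scaledWeights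
weight≃scaledWeight/12 = *≡* refl ∷ *≡* refl ∷ *≡* refl ∷ *≡* refl ∷ *≡* refl ∷ *≡* refl
              ∷ *≡* refl ∷ *≡* refl ∷ *≡* refl ∷ *≡* refl ∷ *≡* refl ∷ []

common-denominator : ∀ k c S d →
  mkℚᵘ (ℤ.+ k) 11 *ᵘ mkℚᵘ (ℤ.+ c) d +ᵘ mkℚᵘ (ℤ.+ S) (pred (12 * suc d))
  ≃ᵘ mkℚᵘ (ℤ.+ (k * c + S)) (pred (12 * suc d))
common-denominator k c S d =
  ℚᵘ.≃-trans (ℚᵘ.+-cong (mkℚᵘ-* k 11 c d) (ℚᵘ.≃-refl {mkℚᵘ (ℤ.+ S) (pred (12 * suc d))}))
  (ℚᵘ.≃-trans (mkℚᵘ-+ (k * c) (pred (12 * suc d)) S (pred (12 * suc d))) (mkℚᵘ-≃ (cancel (k * c) S (12 * suc d))))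
  where
  cancel : ∀ x S D → (x * D + S * D) * D ≡ (x + S) * (D * D)
  cancel = solve-∀

module _ (G : Graph n) {d} (nC4≡ : n C 4 ≡ suc d) where

  toℚᵘ-p : ∀ H → toℚᵘ (p H G) ≃ᵘ mkℚᵘ (ℤ.+ count G H) d
  toℚᵘ-p H = subst (λ m → toℚᵘ (frac (count G H) m) ≃ᵘ mkℚᵘ (ℤ.+ count G H) d)
                   (sym nC4≡) (toℚᵘ-frac (count G H) d)

  -- weightedSum G unfolds definitionally to weightedSumOver weightedClasses.
  weightedSumOver : List (Adj4 × ℚ) → ℚ
  weightedSumOver []             = 0ℚ
  weightedSumOver ((H , w) ∷ hs) = w ℚ.* p H G ℚ.+ weightedSumOver hs

  toℚᵘ-weightedSumOver : ∀ {hs ks} → Pointwise (λ Hw k → toℚᵘ (proj₂ Hw) ≃ᵘ mkℚᵘ (ℤ.+ k) 11) hs ks →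
    toℚᵘ (weightedSumOver hs)
    ≃ᵘ mkℚᵘ (ℤ.+ (∑[ Hk ∈ zip (map proj₁ hs) ks ] (proj₂ Hk * count G (proj₁ Hk)))) (pred (12 * suc d))
  toℚᵘ-weightedSumOver []                                  = *≡* refl
  toℚᵘ-weightedSumOver {(H , w) ∷ hs} {k ∷ ks} (w≃k ∷ hs≃ks) = begin
    toℚᵘ (w ℚ.* p H G ℚ.+ weightedSumOver hs)
      ≈⟨ toℚᵘ-homo-+ (w ℚ.* p H G) (weightedSumOver hs) ⟩
    toℚᵘ (w ℚ.* p H G) +ᵘ toℚᵘ (weightedSumOver hs)
      ≈⟨ ℚᵘ.+-cong term (toℚᵘ-weightedSumOver hs≃ks) ⟩
    mkℚᵘ (ℤ.+ k) 11 *ᵘ mkℚᵘ (ℤ.+ count G H) d +ᵘ mkℚᵘ (ℤ.+ S) (pred (12 * suc d))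
      ≈⟨ common-denominator k (count G H) S d ⟩
    mkℚᵘ (ℤ.+ (k * count G H + S)) (pred (12 * suc d)) ∎
    where
    open ℚᵘ.≃-Reasoning
    S : ℕ
    S = ∑[ Hk ∈ zip (map proj₁ hs) ks ] (proj₂ Hk * count G (proj₁ Hk))
    term : toℚᵘ (w ℚ.* p H G) ≃ᵘ mkℚᵘ (ℤ.+ k) 11 *ᵘ mkℚᵘ (ℤ.+ count G H) d
    term = ℚᵘ.≃-trans (toℚᵘ-homo-* w (p H G)) (ℚᵘ.*-cong w≃k (toℚᵘ-p H))

  toℚᵘ-weightedSum : toℚᵘ (weightedSum G) ≃ᵘ mkℚᵘ (ℤ.+ scaledSum (count G)) (pred (12 * suc d))
  toℚᵘ-weightedSum = toℚᵘ-weightedSumOver weight≃scaledWeight/12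

  inΠ : 4 * scoreSum G ≤ 15 * (n C 4) → inΠᵇ G ≡ true
  inΠ le = trans (isYes≗does (weightedSum G ℚ.≤? 5/16)) (dec-true (weightedSum G ℚ.≤? 5/16) weightedSum≤5/16)
    where
    5/16 : ℚ
    5/16 = ℤ.+ 5 ℚ./ 16
    N : ℕ
    N = scaledSum (count G)
    rescale : ∀ N D → 4 * N ≤ 15 * D → N * 16 ≤ 5 * (12 * D)
    rescale N D le = begin
      N * 16        ≡⟨ lhs N ⟩
      4 * (4 * N)   ≤⟨ *-monoʳ-≤ 4 le ⟩
      4 * (15 * D)  ≡⟨ rhs D ⟩
      5 * (12 * D)  ∎
      where
      open ≤-Reasoning
      lhs : ∀ N → N * 16 ≡ 4 * (4 * N)
      lhs = solve-∀
      rhs : ∀ D → 4 * (15 * D) ≡ 5 * (12 * D)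
      rhs = solve-∀
    weightedSum≤5/16 : weightedSum G ≤ℚ 5/16
    weightedSum≤5/16 = toℚᵘ-cancel-≤ (ℚᵘ.≤-respˡ-≃ (ℚᵘ.≃-sym toℚᵘ-weightedSum) (mkℚᵘ-≤ {c = 5} {d = 15}
      (rescale N (suc d) (subst₂ (λ m D → 4 * m ≤ 15 * D) (scoreSum≡scaledSum-count G) nC4≡ le))))

n^[1+k]+[1+k]n^k≤[1+n]^[1+k] : ∀ n k → n ^ suc k + suc k * n ^ k ≤ suc n ^ suc k
n^[1+k]+[1+k]n^k≤[1+n]^[1+k] n zero    = ≤-reflexive (+-comm (n * 1) 1)
n^[1+k]+[1+k]n^k≤[1+n]^[1+k] n (suc k) = begin
  n ^ suc (suc k) + suc (suc k) * n ^ suc k                    ≤⟨ m≤m+n _ (suc k * n ^ k) ⟩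
  n ^ suc (suc k) + suc (suc k) * n ^ suc k + suc k * n ^ k    ≡⟨ expand n k (n ^ k) ⟩
  suc n * (n ^ suc k + suc k * n ^ k)                          ≤⟨ *-monoʳ-≤ (suc n) (n^[1+k]+[1+k]n^k≤[1+n]^[1+k] n k) ⟩
  suc n * suc n ^ suc k                                        ∎
  where
  open ≤-Reasoning
  expand : ∀ n k x → n * (n * x) + (2 + k) * (n * x) + (1 + k) * x ≡ (1 + n) * (n * x + (1 + k) * x)
  expand = solve-∀

k!*nCk≤n^k : ∀ n k → k ! * (n C k) ≤ n ^ k
k!*nCk≤n^k zero    zero    = ≤-refl
k!*nCk≤n^k zero    (suc k) = ≤-reflexive (*-zeroʳ (suc k !))
k!*nCk≤n^k (suc n) zero    = ≤-refl
k!*nCk≤n^k (suc n) (suc k) = begin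
  suc k ! * (suc n C suc k)                        ≡⟨ cong (suc k ! *_) (nCk+nC[k+1]≡[n+1]C[k+1] n k) ⟨
  suc k ! * (n C k + n C suc k)                    ≡⟨ *-distribˡ-+ (suc k !) (n C k) (n C suc k) ⟩
  suc k ! * (n C k) + suc k ! * (n C suc k)        ≡⟨ cong (_+ suc k ! * (n C suc k)) (*-assoc (suc k) (k !) (n C k)) ⟩
  suc k * (k ! * (n C k)) + suc k ! * (n C suc k)
    ≤⟨ +-mono-≤ (*-monoʳ-≤ (suc k) (k!*nCk≤n^k n k)) (k!*nCk≤n^k n (suc k)) ⟩
  suc k * n ^ k + n ^ suc k                        ≡⟨ +-comm (suc k * n ^ k) (n ^ suc k) ⟩
  n ^ suc k + suc k * n ^ k                        ≤⟨ n^[1+k]+[1+k]n^k≤[1+n]^[1+k] n k ⟩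
  suc n ^ suc k                                    ∎
  where open ≤-Reasoning

0<nCk : ∀ {n k} → k ≤ n → 0 < n C k
0<nCk {n}     {zero}  _         = ≤-refl
0<nCk {suc n} {suc k} (s≤s k≤n) =
  ≤-trans (0<nCk k≤n) (≤-trans (m≤m+n (n C k) _) (≤-reflexive (nCk+nC[k+1]≡[n+1]C[k+1] n k)))

suc[15nC4]≤2n^4 : ∀ n .{{_ : NonZero n}} → suc (15 * (n C 4)) ≤ 2 * n ^ 4
suc[15nC4]≤2n^4 n = begin
  suc (15 * (n C 4))     ≡⟨ +-comm 1 _ ⟩
  15 * (n C 4) + 1       ≤⟨ +-mono-≤ (*-monoˡ-≤ (n C 4) (m≤m+n 15 9)) ≤-refl ⟩
  4 ! * (n C 4) + 1      ≤⟨ +-mono-≤ (k!*nCk≤n^k n 4) (m^n>0 n 4) ⟩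
  n ^ 4 + n ^ 4          ≡⟨ cong (n ^ 4 +_) (+-identityʳ (n ^ 4)) ⟨
  2 * n ^ 4              ∎
  where open ≤-Reasoning

≤-cancel-mean : ∀ L S K Q → S ≡ L * K → L * suc K ≤ S + suc K * Q → L ≤ suc K * Q
≤-cancel-mean L S K Q S≡LK le = +-cancelˡ-≤ (L * K) L (suc K * Q) (begin
  L * K + L           ≡⟨ trans (+-comm (L * K) L) (sym (*-suc L K)) ⟩
  L * suc K           ≤⟨ le ⟩
  S + suc K * Q       ≡⟨ cong (_+ suc K * Q) S≡LK ⟩
  L * K + suc K * Q   ∎)
  where open ≤-Reasoning

length-allGraphs≤ : ∀ n .{{_ : NonZero (n C 4)}} →
                    length (allGraphs n) ≤ suc (15 * (n C 4)) * length (filterᵇ inΠᵇ (allGraphs n))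
length-allGraphs≤ n =
  ≤-cancel-mean (length (allGraphs n)) (∑[ G ∈ allGraphs n ] 4 * scoreSum G) (15 * (n C 4))
                (length (filterᵇ inΠᵇ (allGraphs n)))
  expected (markov (allGraphs n) (λ G → 4 * scoreSum G) inΠᵇ (15 * (n C 4))
                   (λ G → inΠ G (sym (suc-pred (n C 4)))))
  where
  expected : ∑[ G ∈ allGraphs n ] 4 * scoreSum G ≡ length (allGraphs n) * (15 * (n C 4))
  expected = trans (∑-scoreSum n) (trans (cong (15 * length (allGraphs n) *_) (length-subsets4 n))
                                          (rearrange (length (allGraphs n)) (n C 4)))
    where
    rearrange : ∀ L C → 15 * L * C ≡ L * (15 * C)
    rearrange = solve-∀

lemma2p5 : (n : ℕ) → 4 ≤ n → frac 1 (2 * n ^ 4) ≤ℚ probΠ n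
lemma2p5 n 4≤n = frac-≤ (begin
  1 * 2 ^ (n C 2)              ≡⟨ *-identityˡ _ ⟩
  2 ^ (n C 2)                  ≡⟨ length-allGraphs n ⟨
  length (allGraphs n)         ≤⟨ length-allGraphs≤ n ⟩
  suc (15 * (n C 4)) * Q       ≤⟨ *-monoˡ-≤ Q (suc[15nC4]≤2n^4 n) ⟩
  2 * n ^ 4 * Q                ≡⟨ *-comm (2 * n ^ 4) Q ⟩
  Q * (2 * n ^ 4)              ∎)
  where
  open ≤-Reasoning
  Q : ℕ
  Q = length (filterᵇ inΠᵇ (allGraphs n))
  instance
    n≢0 : NonZero n
    n≢0 = >-nonZero (≤-trans (s≤s z≤n) 4≤n)
    nC4≢0 : NonZero (n C 4)
    nC4≢0 = >-nonZero (0<nCk 4≤n)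
    2n^4≢0 : NonZero (2 * n ^ 4)
    2n^4≢0 = m*n≢0 2 (n ^ 4) {{_}} {{m^n≢0 n 4}}
    2^nC2≢0 : NonZero (2 ^ (n C 2))
    2^nC2≢0 = m^n≢0 2 (n C 2)
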